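{- Let $q\ge3$, $r>0$ and $a\in\{0,\dots,d-1\}$. The sequence $(A(r,s,a))_{\max(a-r+1,0)\le s\le\min(a,d-r)}$ is unimodal. More precisely, for integers $s$ with $\max(a-r+1,0)\le s\le\min(a,d-r)-1$: (a) if $2s+\epsilon-a\ge\frac12$, then $A(r,s,a)>A(r,s+1,a)$; (b) if $2s+\epsilon-a\le-\frac12$, then $A(r,s,a)<A(r,s+1,a)$.
   Context: $q$ is a prime power, $d\ge1$ an integer, and $\epsilon\in\{0,\frac12,1,\frac32,2\}$ is the type of a finite classical polar space ($\epsilon=0,\frac12,1,1,\frac32,2$ for $Q^+(2d-1,q)$, $H(2d-1,q)$, $Q(2d,q)$, $W(2d-1,q)$, $H(2d,q)$, $Q^-(2d+1,q)$). $A(r,s,a):=\genfrac{[}{]}{0pt}{}{d-r}{s}_q q^{\binom{d-r-s}{2}+(d-r-s)\epsilon}\genfrac{[}{]}{0pt}{}{r-1}{a-s}_q q^{\binom{r-a+s}{2}}$, where $\genfrac{[}{]}{0pt}{}{n}{k}_q=\prod_{i=1}^k\frac{q^{n-i+1}-1}{q^i-1}$ for $0\le k\le n$ and $0$ otherwise, and $\binom m2=m(m-1)/2$. -}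

module Defs where

open import Data.Nat using (ℕ; zero; suc; _+_; _*_; _∸_; _^_; _≟_; _≤?_)
open import Data.Nat.DivMod using (_/_)
open import Data.Nat.Base using (≢-nonZero)
open import Data.Nat.Primality using (Prime)
open import Data.Product using (Σ; _×_)
open import Relation.Binary.PropositionalEquality using (_≡_)
open import Relation.Nullary using (yes; no)

IsPrimePower : ℕ → Set
IsPrimePower q = Σ ℕ λ p → Σ ℕ λ k → Prime p × (q ≡ p ^ suc k)

choose2 : ℕ → ℕ
choose2 m = (m * (m ∸ 1)) / 2

gNum : ℕ → ℕ → ℕ → ℕ
gNum q n zero    = 1
gNum q n (suc k) = gNum q n k * (q ^ (n ∸ k) ∸ 1)

gDen : ℕ → ℕ → ℕ
gDen q zero    = 1
gDen q (suc k) = gDen q k * (q ^ suc k ∸ 1)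

-- Gaussian binomial [n k]_q = ∏_{i=1}^k (q^{n-i+1}-1)/(q^i-1) for 0 ≤ k ≤ n, and 0 otherwise.
-- (The quotient is exact for q ≥ 2; the degenerate zero-denominator case is irrelevant.)
gauss : ℕ → ℕ → ℕ → ℕ
gauss q n k with k ≤? n | gDen q k ≟ 0
... | no _  | _      = 0
... | yes _ | yes _  = 0
... | yes _ | no d≢0 = (gNum q n k / gDen q k) {{≢-nonZero d≢0}}

-- e = 2ε ∈ {0,1,2,3,4}.  A(r,s,a)^2, where
-- A(r,s,a) = [d-r, s]_q q^{binom(d-r-s,2) + (d-r-s)ε} [r-1, a-s]_q q^{binom(r-a+s,2)}.
-- Used only when s ≤ a, r ≥ 1, s + r ≤ d and s + r ≥ a (so all ∸ are honest subtractions).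
Asq : (q e d r s a : ℕ) → ℕ
Asq q e d r s a =
  (gauss q (d ∸ r) s * gauss q (r ∸ 1) (a ∸ s)) ^ 2
  * q ^ (2 * choose2 (d ∸ r ∸ s) + (d ∸ r ∸ s) * e + 2 * choose2 (r + s ∸ a))

-- Write a = s + 1 + b, r = b + t + 2, d = r + s + c + 1 and e = 2ε.  The absorption identity
-- [n, k+1] (q^(k+1) - 1) = [n, k] (q^(n-k) - 1) and binom(k+1, 2) = binom(k, 2) + k give
--   A(r,s,a)² (q^(b+1) - 1)² (q^(c+1) - 1)² q^(2t+2) = A(r,s+1,a)² (q^(s+1) - 1)² (q^(t+1) - 1)² q^(2c+e).
-- For v ≤ x one has (q^v - 1) q^x ≤ (q^x - 1) q^v, and for q ≥ 3 also 2 q^y ≤ 3 (q^y - 1), whence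
--   (q^v - 1)² (q^u - 1)² q^l ≤ (9/4) q^(2v + 2u + l - 2x - 2y - k) (q^x - 1)² (q^y - 1)² q^k,
-- which is a strict inequality between the two weights once that exponent is negative.  Hypothesis (a)
-- (together with e ≤ 4) makes this apply to (v, u, x, y) = (b+1, c+1, s+1, t+1), hypothesis (b) to
-- (s+1, t+1, b+1, c+1).
module Submission where

open import Defs
open import Data.List.Base using (_∷_; [])
open import Data.Nat
open import Data.Nat.DivMod using (m*n/n≡m; +-distrib-/-∣ʳ)
open import Data.Nat.Divisibility using (divides-refl)
open import Data.Nat.Properties
open import Algebra.Properties.CommutativeSemigroup *-commutativeSemigroup using (xy∙z≈xz∙y)
open import Data.Nat.Tactic.RingSolver using (solve; solve-∀)
open import Data.Product using (_×_; _,_; ∃-syntax)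
open import Relation.Binary.PropositionalEquality
open import Relation.Nullary using (yes; no)
open import Relation.Nullary.Negation using (contradiction)

pow∸1 : ℕ → ℕ → ℕ
pow∸1 q i = q ^ i ∸ 1

pow-pos : ∀ {q} i → 1 ≤ q → 1 ≤ q ^ i
pow-pos {q} i q≥1 = m^n>0 q {{>-nonZero q≥1}} i

suc-pow∸1 : ∀ {q} i → 1 ≤ q → suc (pow∸1 q i) ≡ q ^ i
suc-pow∸1 i q≥1 = trans (+-comm 1 _) (m∸n+n≡m (pow-pos i q≥1))

pow∸1-pos : ∀ {q} i → 2 ≤ q → 1 ≤ pow∸1 q (suc i)
pow∸1-pos i q≥2 = m+n≤o⇒m≤o∸n 1 (*-mono-≤ q≥2 (pow-pos i (≤-trans (s≤s z≤n) q≥2)))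

pow∸1-+ : ∀ {q} k j → 1 ≤ q → pow∸1 q k + q ^ k * pow∸1 q j ≡ pow∸1 q (k + j)
pow∸1-+ {q} k j q≥1 = suc-injective (begin
  suc (pow∸1 q k) + q ^ k * pow∸1 q j ≡⟨ cong (_+ q ^ k * pow∸1 q j) (suc-pow∸1 k q≥1) ⟩
  q ^ k + q ^ k * pow∸1 q j           ≡⟨ sym (*-suc (q ^ k) (pow∸1 q j)) ⟩
  q ^ k * suc (pow∸1 q j)             ≡⟨ cong (q ^ k *_) (suc-pow∸1 j q≥1) ⟩
  q ^ k * q ^ j                       ≡⟨ sym (^-distribˡ-+-* q k j) ⟩
  q ^ (k + j)                         ≡⟨ sym (suc-pow∸1 (k + j) q≥1) ⟩
  suc (pow∸1 q (k + j))               ∎)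
  where open ≡-Reasoning

-- `gauss` is a quotient; this recursive form of the Gaussian binomial makes exactness and positivity visible.
qBinom : ℕ → ℕ → ℕ → ℕ
qBinom q n       zero    = 1
qBinom q zero    (suc k) = 0
qBinom q (suc n) (suc k) = qBinom q n k + q ^ suc k * qBinom q n (suc k)

qBinom-pos : ∀ q {n k} → k ≤ n → 1 ≤ qBinom q n k
qBinom-pos q {n}     {zero}  _         = ≤-refl
qBinom-pos q {suc n} {suc k} (s≤s k≤n) = ≤-trans (qBinom-pos q k≤n) (m≤m+n _ _)

gNum-suc-suc : ∀ q n k → gNum q (suc n) (suc k) ≡ pow∸1 q (suc n) * gNum q n k
gNum-suc-suc q n zero    = *-comm 1 _
gNum-suc-suc q n (suc k) rewrite gNum-suc-suc q n k = *-assoc (pow∸1 q (suc n)) _ _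

gNum-vanishes : ∀ q {n k} → n < k → gNum q n k ≡ 0
gNum-vanishes q {n} {suc k} (s≤s n≤k) rewrite m≤n⇒m∸n≡0 n≤k = *-zeroʳ (gNum q n k)

gNum-pascal : ∀ {q} n k → 1 ≤ q
  → gNum q n k * (pow∸1 q (suc k) + q ^ suc k * pow∸1 q (n ∸ k)) ≡ gNum q (suc n) (suc k)
gNum-pascal {q} n k q≥1 with k ≤? n
... | yes k≤n = begin
  gNum q n k * (pow∸1 q (suc k) + q ^ suc k * pow∸1 q (n ∸ k))
    ≡⟨ cong (gNum q n k *_) (pow∸1-+ (suc k) (n ∸ k) q≥1) ⟩
  gNum q n k * pow∸1 q (suc (k + (n ∸ k)))
    ≡⟨ cong (λ i → gNum q n k * pow∸1 q (suc i)) (m+[n∸m]≡n k≤n) ⟩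
  gNum q n k * pow∸1 q (suc n)
    ≡⟨ *-comm (gNum q n k) _ ⟩
  pow∸1 q (suc n) * gNum q n k
    ≡⟨ sym (gNum-suc-suc q n k) ⟩
  gNum q (suc n) (suc k) ∎
  where open ≡-Reasoning
... | no k≰n rewrite gNum-vanishes q (≰⇒> k≰n) | gNum-vanishes q (s≤s (≰⇒> k≰n)) = refl

qBinom-*-gDen : ∀ {q} → 1 ≤ q → ∀ n k → qBinom q n k * gDen q k ≡ gNum q n k
qBinom-*-gDen         q≥1 n       zero    = refl
qBinom-*-gDen {q}     q≥1 zero    (suc k) = sym (gNum-vanishes q {0} {suc k} (s≤s z≤n))
qBinom-*-gDen {q}     q≥1 (suc n) (suc k) = begin
  (qBinom q n k + q ^ suc k * qBinom q n (suc k)) * (gDen q k * pow∸1 q (suc k))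
    ≡⟨ expand (qBinom q n k) (q ^ suc k) (qBinom q n (suc k)) (gDen q k) (pow∸1 q (suc k)) ⟩
  qBinom q n k * gDen q k * pow∸1 q (suc k) + q ^ suc k * (qBinom q n (suc k) * gDen q (suc k))
    ≡⟨ cong₂ (λ x y → x * pow∸1 q (suc k) + q ^ suc k * y)
             (qBinom-*-gDen q≥1 n k) (qBinom-*-gDen q≥1 n (suc k)) ⟩
  gNum q n k * pow∸1 q (suc k) + q ^ suc k * (gNum q n k * pow∸1 q (n ∸ k))
    ≡⟨ factor (gNum q n k) (pow∸1 q (suc k)) (q ^ suc k) (pow∸1 q (n ∸ k)) ⟩
  gNum q n k * (pow∸1 q (suc k) + q ^ suc k * pow∸1 q (n ∸ k))
    ≡⟨ gNum-pascal n k q≥1 ⟩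
  gNum q (suc n) (suc k) ∎
  where
    open ≡-Reasoning
    expand : ∀ a p b g m → (a + p * b) * (g * m) ≡ a * g * m + p * (b * (g * m))
    expand = solve-∀
    factor : ∀ x m p m′ → x * m + p * (x * m′) ≡ x * (m + p * m′)
    factor = solve-∀

gDen-pos : ∀ {q} → 2 ≤ q → ∀ k → 1 ≤ gDen q k
gDen-pos q≥2 zero    = ≤-refl
gDen-pos q≥2 (suc k) = *-mono-≤ (gDen-pos q≥2 k) (pow∸1-pos k q≥2)

gauss≡qBinom : ∀ {q n k} → 2 ≤ q → k ≤ n → gauss q n k ≡ qBinom q n k
gauss≡qBinom {q} {n} {k} q≥2 k≤n with k ≤? n | gDen q k ≟ 0
... | no k≰n | _          = contradiction k≤n k≰n
... | yes _  | yes gDen≡0 = contradiction (sym gDen≡0) (<⇒≢ (gDen-pos q≥2 k))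
... | yes _  | no gDen≢0  = begin
  gNum q n k / gDen q k                 ≡⟨ cong (_/ gDen q k) (sym (qBinom-*-gDen (≤-trans (s≤s z≤n) q≥2) n k)) ⟩
  qBinom q n k * gDen q k / gDen q k    ≡⟨ m*n/n≡m (qBinom q n k) (gDen q k) ⟩
  qBinom q n k                          ∎
  where
    open ≡-Reasoning
    instance
      gDen-nonZero : NonZero (gDen q k)
      gDen-nonZero = ≢-nonZero gDen≢0

qBinom-absorb : ∀ {q} → 2 ≤ q → ∀ k j
  → qBinom q (k + j) (suc k) * pow∸1 q (suc k) ≡ qBinom q (k + j) k * pow∸1 q j
qBinom-absorb {q} q≥2 k j = *-cancelʳ-≡ _ _ (gDen q k) {{>-nonZero (gDen-pos q≥2 k)}} (begin
  qBinom q n (suc k) * pow∸1 q (suc k) * gDen q k    ≡⟨ xy∙z≈xz∙y (qBinom q n (suc k)) _ _ ⟩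
  qBinom q n (suc k) * gDen q k * pow∸1 q (suc k)    ≡⟨ *-assoc (qBinom q n (suc k)) _ _ ⟩
  qBinom q n (suc k) * gDen q (suc k)                ≡⟨ qBinom-*-gDen q≥1 n (suc k) ⟩
  gNum q n k * pow∸1 q (n ∸ k)                       ≡⟨ cong (λ i → gNum q n k * pow∸1 q i) (m+n∸m≡n k j) ⟩
  gNum q n k * pow∸1 q j                             ≡⟨ cong (_* pow∸1 q j) (sym (qBinom-*-gDen q≥1 n k)) ⟩
  qBinom q n k * gDen q k * pow∸1 q j                ≡⟨ xy∙z≈xz∙y (qBinom q n k) _ _ ⟩
  qBinom q n k * pow∸1 q j * gDen q k                ∎)
  where
    open ≡-Reasoning
    n : ℕ
    n = k + j
    q≥1 : 1 ≤ q
    q≥1 = ≤-trans (s≤s z≤n) q≥2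

choose2-suc : ∀ k → choose2 (suc k) ≡ choose2 k + k
choose2-suc k = begin
  suc k * k / 2                 ≡⟨ cong (_/ 2) (suc-k*k k) ⟩
  (k * (k ∸ 1) + k * 2) / 2     ≡⟨ +-distrib-/-∣ʳ (k * (k ∸ 1)) (divides-refl k) ⟩
  choose2 k + k * 2 / 2         ≡⟨ cong (choose2 k +_) (m*n/n≡m k 2) ⟩
  choose2 k + k                 ∎
  where
    open ≡-Reasoning
    suc-k*k : ∀ k → suc k * k ≡ k * (k ∸ 1) + k * 2
    suc-k*k zero    = refl
    suc-k*k (suc j) = expand j
      where
        expand : ∀ j → suc (suc j) * suc j ≡ suc j * j + suc j * 2
        expand = solve-∀

Asq-unfold : ∀ {q e d r s a n j u w} → 2 ≤ q
  → r + n ≡ d → s + j ≡ a → s + u ≡ n → a + w ≡ r + s → j ≤ r ∸ 1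
  → Asq q e d r s a
    ≡ qBinom q n s * qBinom q (r ∸ 1) j * (qBinom q n s * qBinom q (r ∸ 1) j)
      * q ^ (2 * choose2 u + u * e + 2 * choose2 w)
Asq-unfold {q} {e} {r = r} {s} {j = j} {u} {w} q≥2 refl refl refl a+w≡r+s j≤r∸1
  rewrite m+n∸m≡n r (s + u) | m+n∸m≡n s j | m+n∸m≡n s u | sym a+w≡r+s | m+n∸m≡n (s + j) w
        | gauss≡qBinom {q} q≥2 (m≤m+n s u) | gauss≡qBinom {q} q≥2 j≤r∸1
  = cong (λ x → x * q ^ (2 * choose2 u + u * e + 2 * choose2 w)) (cong (X *_) (*-identityʳ X))
  where
    X : ℕ
    X = qBinom q (s + u) s * qBinom q (r ∸ 1) j

pow∸1-cross : ∀ {q v x} → 1 ≤ q → v ≤ x → pow∸1 q v * q ^ x ≤ pow∸1 q x * q ^ v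
pow∸1-cross {q} {v} {x} q≥1 v≤x = begin
  (q ^ v ∸ 1) * q ^ x       ≡⟨ *-distribʳ-∸ (q ^ x) (q ^ v) 1 ⟩
  q ^ v * q ^ x ∸ 1 * q ^ x ≡⟨ cong₂ _∸_ (*-comm (q ^ v) (q ^ x)) (*-identityˡ (q ^ x)) ⟩
  q ^ x * q ^ v ∸ q ^ x     ≤⟨ ∸-monoʳ-≤ (q ^ x * q ^ v) (^-monoʳ-≤ q {{>-nonZero q≥1}} v≤x) ⟩
  q ^ x * q ^ v ∸ q ^ v     ≡⟨ cong (q ^ x * q ^ v ∸_) (sym (*-identityˡ (q ^ v))) ⟩
  q ^ x * q ^ v ∸ 1 * q ^ v ≡⟨ sym (*-distribʳ-∸ (q ^ v) (q ^ x) 1) ⟩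
  (q ^ x ∸ 1) * q ^ v       ∎
  where open ≤-Reasoning

2*pow≤3*pow∸1 : ∀ {q} y → 3 ≤ q → 2 * q ^ suc y ≤ 3 * pow∸1 q (suc y)
2*pow≤3*pow∸1 {q} y q≥3 = begin
  2 * Q      ≤⟨ m+n≤o⇒m≤o∸n (2 * Q) (begin
                   2 * Q + 3 ≤⟨ +-monoʳ-≤ (2 * Q) Q≥3 ⟩
                   2 * Q + Q ≡⟨ +-comm (2 * Q) Q ⟩
                   3 * Q     ∎) ⟩
  3 * Q ∸ 3  ≡⟨ sym (*-distribˡ-∸ 3 Q 1) ⟩
  3 * (Q ∸ 1) ∎
  where
    open ≤-Reasoning
    Q : ℕ
    Q = q ^ suc y
    Q≥3 : 3 ≤ Q
    Q≥3 = *-mono-≤ q≥3 (pow-pos y (≤-trans (s≤s z≤n) q≥3))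

square-ratio-< : ∀ {A B C D E F} → 1 ≤ B → 1 ≤ C → 1 ≤ F
  → 2 * A * B ≤ 3 * C * D → 3 * (D * D) * E ≤ B * B * F → A * A * E < C * C * F
square-ratio-< {A} {B} {C} {D} {E} {F} B≥1 C≥1 F≥1 AB≤CD D²E≤B²F =
  *-cancelˡ-< (12 * (B * B)) _ _ (begin-strict
    12 * (B * B) * (A * A * E)          ≡⟨ solve (A ∷ B ∷ E ∷ []) ⟩
    3 * (2 * A * B * (2 * A * B)) * E   ≤⟨ *-monoˡ-≤ E (*-monoʳ-≤ 3 (*-mono-≤ AB≤CD AB≤CD)) ⟩
    3 * (3 * C * D * (3 * C * D)) * E   ≡⟨ solve (C ∷ D ∷ E ∷ []) ⟩
    9 * (C * C) * (3 * (D * D) * E)     ≤⟨ *-monoʳ-≤ (9 * (C * C)) D²E≤B²F ⟩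
    9 * (C * C) * (B * B * F)           ≡⟨ *-assoc 9 (C * C) (B * B * F) ⟩
    9 * (C * C * (B * B * F))           <⟨ *-monoˡ-< (C * C * (B * B * F)) {{>-nonZero X≥1}} (m<m+n 9 {3} z<s) ⟩
    12 * (C * C * (B * B * F))          ≡⟨ solve (B ∷ C ∷ F ∷ []) ⟩
    12 * (B * B) * (C * C * F)          ∎)
  where
    open ≤-Reasoning
    X≥1 : 1 ≤ C * C * (B * B * F)
    X≥1 = *-mono-≤ (*-mono-≤ C≥1 C≥1) (*-mono-≤ (*-mono-≤ B≥1 B≥1) F≥1)

pow∸1-product-bound : ∀ {q v u x y} → 3 ≤ q → v ≤ x
  → 2 * (pow∸1 q v * pow∸1 q u) * q ^ (x + suc y) ≤ 3 * (pow∸1 q x * pow∸1 q (suc y)) * q ^ (v + u)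
pow∸1-product-bound {q} {v} {u} {x} {y} q≥3 v≤x = begin
  2 * (pow∸1 q v * pow∸1 q u) * q ^ (x + suc y)
    ≡⟨ cong (2 * (pow∸1 q v * pow∸1 q u) *_) (^-distribˡ-+-* q x (suc y)) ⟩
  2 * (pow∸1 q v * pow∸1 q u) * (q ^ x * q ^ suc y)
    ≡⟨ regroup (pow∸1 q v) (pow∸1 q u) (q ^ x) (q ^ suc y) ⟩
  pow∸1 q v * q ^ x * pow∸1 q u * (2 * q ^ suc y)
    ≤⟨ *-mono-≤ (*-mono-≤ (pow∸1-cross q≥1 v≤x) (m∸n≤m (q ^ u) 1)) (2*pow≤3*pow∸1 y q≥3) ⟩
  pow∸1 q x * q ^ v * q ^ u * (3 * pow∸1 q (suc y))
    ≡⟨ regroup′ (pow∸1 q x) (q ^ v) (q ^ u) (pow∸1 q (suc y)) ⟩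
  3 * (pow∸1 q x * pow∸1 q (suc y)) * (q ^ v * q ^ u)
    ≡⟨ cong (3 * (pow∸1 q x * pow∸1 q (suc y)) *_) (sym (^-distribˡ-+-* q v u)) ⟩
  3 * (pow∸1 q x * pow∸1 q (suc y)) * q ^ (v + u) ∎
  where
    open ≤-Reasoning
    q≥1 : 1 ≤ q
    q≥1 = ≤-trans (s≤s z≤n) q≥3
    regroup : ∀ a b c d → 2 * (a * b) * (c * d) ≡ a * c * b * (2 * d)
    regroup = solve-∀
    regroup′ : ∀ a b c d → a * b * c * (3 * d) ≡ 3 * (a * d) * (b * c)
    regroup′ = solve-∀

3*pow-≤ : ∀ {q w l z k} → 3 ≤ q → w + w + l < z + z + k
  → 3 * (q ^ w * q ^ w) * q ^ l ≤ q ^ z * q ^ z * q ^ k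
3*pow-≤ {q} {w} {l} {z} {k} q≥3 exponents = begin
  3 * (q ^ w * q ^ w) * q ^ l   ≡⟨ *-assoc 3 (q ^ w * q ^ w) (q ^ l) ⟩
  3 * (q ^ w * q ^ w * q ^ l)   ≡⟨ cong (3 *_) (sym (pow-split w l)) ⟩
  3 * q ^ (w + w + l)           ≤⟨ *-monoˡ-≤ (q ^ (w + w + l)) q≥3 ⟩
  q ^ suc (w + w + l)           ≤⟨ ^-monoʳ-≤ q {{>-nonZero (≤-trans (s≤s z≤n) q≥3)}} exponents ⟩
  q ^ (z + z + k)               ≡⟨ pow-split z k ⟩
  q ^ z * q ^ z * q ^ k         ∎
  where
    open ≤-Reasoning
    pow-split : ∀ i j → q ^ (i + i + j) ≡ q ^ i * q ^ i * q ^ j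
    pow-split i j = trans (^-distribˡ-+-* q (i + i) j) (cong (_* q ^ j) (^-distribˡ-+-* q i i))

ratioFactor : ℕ → ℕ → ℕ → ℕ → ℕ
ratioFactor q v u l = pow∸1 q v * pow∸1 q u * (pow∸1 q v * pow∸1 q u) * q ^ l

ratioFactor-< : ∀ {q v u l x y k} → 3 ≤ q → v ≤ suc x
  → v + u + (v + u) + l < suc x + suc y + (suc x + suc y) + k
  → ratioFactor q v u l < ratioFactor q (suc x) (suc y) k
ratioFactor-< {q} {v} {u} {l} {x} {y} {k} q≥3 v≤x exponents =
  square-ratio-< {A = pow∸1 q v * pow∸1 q u} {B = q ^ (suc x + suc y)}
                 {C = pow∸1 q (suc x) * pow∸1 q (suc y)} {D = q ^ (v + u)}
    (pow-pos (suc x + suc y) q≥1) (*-mono-≤ (pow∸1-pos x q≥2) (pow∸1-pos y q≥2)) (pow-pos k q≥1)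
    (pow∸1-product-bound q≥3 v≤x) (3*pow-≤ {q} {v + u} {l} {suc x + suc y} {k} q≥3 exponents)
  where
    q≥1 : 1 ≤ q
    q≥1 = ≤-trans (s≤s z≤n) q≥3
    q≥2 : 2 ≤ q
    q≥2 = ≤-trans (s≤s (s≤s z≤n)) q≥3

scaled-<⇒< : ∀ {x y z k p p′} → 1 ≤ k → x * z ≡ k * p → y * z ≡ k * p′ → p < p′ → x < y
scaled-<⇒< {x} {y} {z} {k} k≥1 xz≡kp yz≡kp′ p<p′ =
  *-cancelʳ-< z x y (subst₂ _<_ (sym xz≡kp) (sym yz≡kp′) (*-monoʳ-< k {{>-nonZero k≥1}} p<p′))

-- In these coordinates every truncated subtraction in `Asq` at s and at s + 1 is an honest one.
module AsqStep {q : ℕ} (q≥3 : 3 ≤ q) (e s b t c : ℕ) where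

  n m d r a : ℕ
  n = s + suc c
  m = b + suc t
  r = suc m
  d = r + n
  a = s + suc b

  q≥2 : 2 ≤ q
  q≥2 = ≤-trans (s≤s (s≤s z≤n)) q≥3

  E₀ : ℕ
  E₀ = 2 * choose2 c + c * e + 2 * choose2 (suc t)

  g₁ g₂ g₃ g₄ : ℕ
  g₁ = qBinom q n s
  g₂ = qBinom q m (suc b)
  g₃ = qBinom q n (suc s)
  g₄ = qBinom q m b

  K S : ℕ
  K = g₁ * g₄ * (g₁ * g₄) * q ^ E₀
  S = pow∸1 q (suc s) * pow∸1 q (suc b) * (pow∸1 q (suc s) * pow∸1 q (suc b))

  K-pos : 1 ≤ K
  K-pos = *-mono-≤ (*-mono-≤ g₁g₄≥1 g₁g₄≥1) (pow-pos E₀ (≤-trans (s≤s z≤n) q≥3))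
    where
      g₁g₄≥1 : 1 ≤ g₁ * g₄
      g₁g₄≥1 = *-mono-≤ (qBinom-pos q (m≤m+n s (suc c))) (qBinom-pos q (m≤m+n b (suc t)))

  Asq-at-s : Asq q e d r s a ≡ g₁ * g₂ * (g₁ * g₂) * (q ^ E₀ * q ^ (2 * c + e))
  Asq-at-s = begin
    Asq q e d r s a
      ≡⟨ Asq-unfold {q} {e} {d} {r} {s} {a} {n} {suc b} {suc c} {suc t} q≥2 refl refl refl (regroup s b t)
                    (subst (suc b ≤_) (sym (+-suc b t)) (s≤s (m≤m+n b t))) ⟩
    g₁ * g₂ * (g₁ * g₂) * q ^ (2 * choose2 (suc c) + suc c * e + 2 * choose2 (suc t))
      ≡⟨ cong (λ i → g₁ * g₂ * (g₁ * g₂) * q ^ i) exponent ⟩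
    g₁ * g₂ * (g₁ * g₂) * q ^ (E₀ + (2 * c + e))
      ≡⟨ cong (g₁ * g₂ * (g₁ * g₂) *_) (^-distribˡ-+-* q E₀ (2 * c + e)) ⟩
    g₁ * g₂ * (g₁ * g₂) * (q ^ E₀ * q ^ (2 * c + e)) ∎
    where
      open ≡-Reasoning
      regroup : ∀ s b t → s + suc b + suc t ≡ suc (b + suc t) + s
      regroup = solve-∀
      shift : ∀ C T → 2 * (C + c) + suc c * e + 2 * T ≡ 2 * C + c * e + 2 * T + (2 * c + e)
      shift C T = solve (C ∷ T ∷ c ∷ e ∷ [])
      exponent : 2 * choose2 (suc c) + suc c * e + 2 * choose2 (suc t) ≡ E₀ + (2 * c + e)
      exponent rewrite choose2-suc c = shift (choose2 c) (choose2 (suc t))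

  Asq-at-suc-s : Asq q e d r (suc s) a ≡ g₃ * g₄ * (g₃ * g₄) * (q ^ E₀ * q ^ (2 * suc t))
  Asq-at-suc-s = begin
    Asq q e d r (suc s) a
      ≡⟨ Asq-unfold {q} {e} {d} {r} {suc s} {a} {n} {b} {c} {suc (suc t)} q≥2 refl (sym (+-suc s b)) (sym (+-suc s c))
                    (regroup s b t) (m≤m+n b (suc t)) ⟩
    g₃ * g₄ * (g₃ * g₄) * q ^ (2 * choose2 c + c * e + 2 * choose2 (suc (suc t)))
      ≡⟨ cong (λ i → g₃ * g₄ * (g₃ * g₄) * q ^ i) exponent ⟩
    g₃ * g₄ * (g₃ * g₄) * q ^ (E₀ + 2 * suc t)
      ≡⟨ cong (g₃ * g₄ * (g₃ * g₄) *_) (^-distribˡ-+-* q E₀ (2 * suc t)) ⟩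
    g₃ * g₄ * (g₃ * g₄) * (q ^ E₀ * q ^ (2 * suc t)) ∎
    where
      open ≡-Reasoning
      regroup : ∀ s b t → s + suc b + suc (suc t) ≡ suc (b + suc t) + suc s
      regroup = solve-∀
      shift : ∀ C T → 2 * C + c * e + 2 * (T + suc t) ≡ 2 * C + c * e + 2 * T + 2 * suc t
      shift C T = solve (C ∷ T ∷ c ∷ e ∷ t ∷ [])
      exponent : 2 * choose2 c + c * e + 2 * choose2 (suc (suc t)) ≡ E₀ + 2 * suc t
      exponent rewrite choose2-suc (suc t) = shift (choose2 c) (choose2 (suc t))

  Asq-at-s-scaled : Asq q e d r s a * S ≡ K * ratioFactor q (suc s) (suc t) (2 * c + e)
  Asq-at-s-scaled = begin
    Asq q e d r s a * S
      ≡⟨ cong (_* S) Asq-at-s ⟩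
    g₁ * g₂ * (g₁ * g₂) * (q ^ E₀ * q ^ (2 * c + e)) * S
      ≡⟨ regroup g₁ g₂ Mx Mv (q ^ E₀) (q ^ (2 * c + e)) ⟩
    g₁ * g₁ * (g₂ * Mv * (g₂ * Mv)) * (Mx * Mx) * q ^ E₀ * q ^ (2 * c + e)
      ≡⟨ cong (λ x → g₁ * g₁ * (x * x) * (Mx * Mx) * q ^ E₀ * q ^ (2 * c + e)) g₂Mv≡g₄My ⟩
    g₁ * g₁ * (g₄ * My * (g₄ * My)) * (Mx * Mx) * q ^ E₀ * q ^ (2 * c + e)
      ≡⟨ regroup′ g₁ g₄ Mx My (q ^ E₀) (q ^ (2 * c + e)) ⟩
    K * ratioFactor q (suc s) (suc t) (2 * c + e) ∎
    where
      open ≡-Reasoning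
      Mx Mv My : ℕ
      Mx = pow∸1 q (suc s)
      Mv = pow∸1 q (suc b)
      My = pow∸1 q (suc t)
      g₂Mv≡g₄My : g₂ * Mv ≡ g₄ * My
      g₂Mv≡g₄My = qBinom-absorb q≥2 b (suc t)
      regroup : ∀ g₁ g₂ Mx Mv P Q
        → g₁ * g₂ * (g₁ * g₂) * (P * Q) * (Mx * Mv * (Mx * Mv)) ≡ g₁ * g₁ * (g₂ * Mv * (g₂ * Mv)) * (Mx * Mx) * P * Q
      regroup = solve-∀
      regroup′ : ∀ g₁ g₄ Mx My P Q
        → g₁ * g₁ * (g₄ * My * (g₄ * My)) * (Mx * Mx) * P * Q ≡ g₁ * g₄ * (g₁ * g₄) * P * (Mx * My * (Mx * My) * Q)
      regroup′ = solve-∀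

  Asq-at-suc-s-scaled : Asq q e d r (suc s) a * S ≡ K * ratioFactor q (suc b) (suc c) (2 * suc t)
  Asq-at-suc-s-scaled = begin
    Asq q e d r (suc s) a * S
      ≡⟨ cong (_* S) Asq-at-suc-s ⟩
    g₃ * g₄ * (g₃ * g₄) * (q ^ E₀ * q ^ (2 * suc t)) * S
      ≡⟨ regroup g₃ g₄ Mx Mv (q ^ E₀) (q ^ (2 * suc t)) ⟩
    g₃ * Mx * (g₃ * Mx) * (g₄ * g₄) * (Mv * Mv) * q ^ E₀ * q ^ (2 * suc t)
      ≡⟨ cong (λ x → x * x * (g₄ * g₄) * (Mv * Mv) * q ^ E₀ * q ^ (2 * suc t)) g₃Mx≡g₁Mu ⟩
    g₁ * Mu * (g₁ * Mu) * (g₄ * g₄) * (Mv * Mv) * q ^ E₀ * q ^ (2 * suc t)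
      ≡⟨ regroup′ g₁ g₄ Mv Mu (q ^ E₀) (q ^ (2 * suc t)) ⟩
    K * ratioFactor q (suc b) (suc c) (2 * suc t) ∎
    where
      open ≡-Reasoning
      Mx Mv Mu : ℕ
      Mx = pow∸1 q (suc s)
      Mv = pow∸1 q (suc b)
      Mu = pow∸1 q (suc c)
      g₃Mx≡g₁Mu : g₃ * Mx ≡ g₁ * Mu
      g₃Mx≡g₁Mu = qBinom-absorb q≥2 s (suc c)
      regroup : ∀ g₃ g₄ Mx Mv P Q
        → g₃ * g₄ * (g₃ * g₄) * (P * Q) * (Mx * Mv * (Mx * Mv)) ≡ g₃ * Mx * (g₃ * Mx) * (g₄ * g₄) * (Mv * Mv) * P * Q
      regroup = solve-∀
      regroup′ : ∀ g₁ g₄ Mv Mu P Q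
        → g₁ * Mu * (g₁ * Mu) * (g₄ * g₄) * (Mv * Mv) * P * Q ≡ g₁ * g₄ * (g₁ * g₄) * P * (Mv * Mu * (Mv * Mu) * Q)
      regroup′ = solve-∀

  decreasing : e ≤ 4 → 2 * a + 1 ≤ 4 * s + e → Asq q e d r s a > Asq q e d r (suc s) a
  decreasing e≤4 h = scaled-<⇒< K-pos Asq-at-suc-s-scaled Asq-at-s-scaled (ratioFactor-< q≥3 (s≤s b≤s) exponents)
    where
      open ≤-Reasoning
      h′ : 2 * b + 3 ≤ 2 * s + e
      h′ = +-cancelˡ-≤ (2 * s) _ _ (begin
        2 * s + (2 * b + 3)   ≡⟨ solve (s ∷ b ∷ []) ⟩
        2 * (s + suc b) + 1   ≤⟨ h ⟩
        4 * s + e             ≡⟨ solve (s ∷ e ∷ []) ⟩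
        2 * s + (2 * s + e)   ∎)
      b≤s : b ≤ s
      b≤s = ≤-pred (*-cancelˡ-< 2 b (suc s) (+-cancelʳ-≤ 2 _ _ (begin
        suc (2 * b) + 2       ≡⟨ solve (b ∷ []) ⟩
        2 * b + 3             ≤⟨ h′ ⟩
        2 * s + e             ≤⟨ +-monoʳ-≤ (2 * s) e≤4 ⟩
        2 * s + 4             ≡⟨ solve (s ∷ []) ⟩
        2 * suc s + 2         ∎)))
      exponents : suc b + suc c + (suc b + suc c) + 2 * suc t < suc s + suc t + (suc s + suc t) + (2 * c + e)
      exponents = begin-strict
        suc b + suc c + (suc b + suc c) + 2 * suc t       <⟨ n<1+n _ ⟩
        suc (suc b + suc c + (suc b + suc c) + 2 * suc t) ≡⟨ solve (b ∷ c ∷ t ∷ []) ⟩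
        (2 * b + 3) + (2 * c + 2 * t + 4)                  ≤⟨ +-monoˡ-≤ (2 * c + 2 * t + 4) h′ ⟩
        (2 * s + e) + (2 * c + 2 * t + 4)                  ≡⟨ solve (s ∷ e ∷ c ∷ t ∷ []) ⟩
        suc s + suc t + (suc s + suc t) + (2 * c + e)     ∎

  increasing : 4 * s + e + 1 ≤ 2 * a → Asq q e d r s a < Asq q e d r (suc s) a
  increasing h = scaled-<⇒< K-pos Asq-at-s-scaled Asq-at-suc-s-scaled (ratioFactor-< q≥3 (s≤s s≤b) exponents)
    where
      open ≤-Reasoning
      h′ : 2 * s + e + 1 ≤ 2 * b + 2
      h′ = +-cancelˡ-≤ (2 * s) _ _ (begin
        2 * s + (2 * s + e + 1) ≡⟨ solve (s ∷ e ∷ []) ⟩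
        4 * s + e + 1           ≤⟨ h ⟩
        2 * (s + suc b)         ≡⟨ solve (s ∷ b ∷ []) ⟩
        2 * s + (2 * b + 2)     ∎)
      s≤b : s ≤ b
      s≤b = ≤-pred (*-cancelˡ-< 2 s (suc b) (begin
        suc (2 * s)             ≡⟨ solve (s ∷ []) ⟩
        2 * s + 1               ≤⟨ +-monoˡ-≤ 1 (m≤m+n (2 * s) e) ⟩
        2 * s + e + 1           ≤⟨ h′ ⟩
        2 * b + 2               ≡⟨ solve (b ∷ []) ⟩
        2 * suc b               ∎))
      exponents : suc s + suc t + (suc s + suc t) + (2 * c + e) < suc b + suc c + (suc b + suc c) + 2 * suc t
      exponents = begin-strict
        suc s + suc t + (suc s + suc t) + (2 * c + e)       <⟨ n<1+n _ ⟩
        suc (suc s + suc t + (suc s + suc t) + (2 * c + e)) ≡⟨ solve (s ∷ t ∷ c ∷ e ∷ []) ⟩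
        (2 * s + e + 1) + (2 * c + 2 * t + 4)                ≤⟨ +-monoˡ-≤ (2 * c + 2 * t + 4) h′ ⟩
        (2 * b + 2) + (2 * c + 2 * t + 4)                    ≡⟨ solve (b ∷ c ∷ t ∷ []) ⟩
        suc b + suc c + (suc b + suc c) + 2 * suc t         ∎

admissible-shape : ∀ {d r a s} → a + 1 ≤ s + r → s + 1 ≤ a → s + 1 + r ≤ d
  → ∃[ b ] ∃[ t ] ∃[ c ] (a ≡ s + suc b × r ≡ suc (b + suc t) × d ≡ r + (s + suc c))
admissible-shape {d} {r} {a} {s} a<s+r s<a s+r<d
  with m≤n⇒∃[o]m+o≡n s<a | m≤n⇒∃[o]m+o≡n a<s+r | m≤n⇒∃[o]m+o≡n s+r<d
... | b , refl | t , a+1+t≡s+r | c , refl =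
  b , t , c , +-assoc s 1 b
  , +-cancelˡ-≡ s r (suc (b + suc t)) (trans (sym a+1+t≡s+r) (solve (s ∷ b ∷ t ∷ [])))
  , solve (s ∷ r ∷ c ∷ [])

lemma8p5 : (q d e r a s : ℕ) → IsPrimePower q → 3 ≤ q → 1 ≤ d → e ≤ 4 → 0 < r → a < d
    → a + 1 ≤ s + r → s + 1 ≤ a → s + 1 + r ≤ d
    → (2 * a + 1 ≤ 4 * s + e → Asq q e d r s a > Asq q e d r (suc s) a)
      × (4 * s + e + 1 ≤ 2 * a → Asq q e d r s a < Asq q e d r (suc s) a)
lemma8p5 q d e r a s _ q≥3 _ e≤4 _ _ a<s+r s<a s+r<d with admissible-shape a<s+r s<a s+r<d
... | b , t , c , refl , refl , refl = decreasing e≤4 , increasing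
  where open AsqStep q≥3 e s b t c
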